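{- Let $K$ be a field of characteristic $0$ and $g(z)=\sum_{k\ge0}a_kz^k\in K[[z]]$. Then \[ \mathcal{M}^{ -1}(g)(z)=\sum_{k=0}^\infty\frac{(-1)^{k+1}a_k\,k!}{z(z+1)\cdots(z+k)}, \] where each $1/(z(z+1)\cdots(z+k))$ is expanded in $(1/z)K[[1/z]]$ (the sum converges $1/z$-adically).
   Context: Modified inverse Mellin transform $\mathcal{M}^{ -1}:K[[z]]\to(1/z)K[[1/z]]$: for $g\in K[[z]]$, write $g(e^z-1)=\sum_{k\ge0}b_kz^k/k!$ (with $e^z=\sum z^n/n!$) and set $\mathcal{M}^{ -1}(g)=\sum_{k\ge0}b_k(-1/z)^{k+1}$. -}

module Defs where

open import Level using (Level; _⊔_) renaming (suc to lsuc)
open import Algebra.Bundles using (CommutativeRing)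
open import Data.Nat using (ℕ; zero; suc; _∸_) renaming (_! to _!ℕ)
open import Data.Nat.Properties using (_!≢0)
open import Data.Product using (Σ; proj₁; _,_)
open import Relation.Nullary using (¬_)

record Field (c ℓ : Level) : Set (lsuc (c ⊔ ℓ)) where
  field
    commutativeRing : CommutativeRing c ℓ
  open CommutativeRing commutativeRing public
  field
    0≉1     : ¬ (0# ≈ 1#)
    inverse : ∀ x → ¬ (x ≈ 0#) → Σ Carrier (λ y → x * y ≈ 1#)

module _ {c ℓ : Level} (F : Field c ℓ) where
  open Field F using (Carrier; _≈_; _+_; 0#; 1#)

  ι : ℕ → Carrier
  ι zero    = 0#
  ι (suc n) = 1# + ι n

  CharZero : Set ℓ
  CharZero = ∀ n → ¬ (ι (suc n) ≈ 0#)

-- Formal power series over K, in z or in w = 1/z, are coefficient sequences.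
module PowerSeries {c ℓ : Level} (F : Field c ℓ) (char0 : CharZero F) where
  open Field F using (Carrier; _≈_; _+_; _*_; -_; 0#; 1#; inverse)

  Series : Set c
  Series = ℕ → Carrier

  ∑≤ : ℕ → (ℕ → Carrier) → Carrier
  ∑≤ zero    f = f zero
  ∑≤ (suc n) f = ∑≤ n f + f (suc n)

  _^K_ : Carrier → ℕ → Carrier
  x ^K zero  = 1#
  x ^K suc m = x * (x ^K m)

  sgn : ℕ → Carrier
  sgn k = (- 1#) ^K k

  _⋆_ : Series → Series → Series
  (f ⋆ g) n = ∑≤ n (λ i → f i * g (n ∸ i))

  one : Series
  one zero    = 1#
  one (suc n) = 0#

  _^S_ : Series → ℕ → Series
  f ^S zero  = one
  f ^S suc m = f ⋆ (f ^S m)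

  invFact : ℕ → Carrier
  invFact n with n !ℕ | n !≢0
  ... | zero  | p = 0#  -- impossible case
  ... | suc m | _ = proj₁ (inverse (ι F (suc m)) (char0 m))

  expMinusOne : Series
  expMinusOne zero    = 0#
  expMinusOne (suc n) = invFact (suc n)

  -- composition g(h) for h with zero constant term:
  -- [z^n] g(h) = Σ_{m=0}^{n} g_m [z^n] h^m  (terms m > n vanish)
  compose : Series → Series → Series
  compose g h n = ∑≤ n (λ m → g m * (h ^S m) n)

  -- b_k with g(e^z - 1) = Σ b_k z^k / k!
  bcoef : Series → ℕ → Carrier
  bcoef g k = ι F (k !ℕ) * compose g expMinusOne k

  -- modified inverse Mellin transform M^{-1}(g) = Σ_k b_k (-1/z)^{k+1},
  -- as a series in w = 1/z: coefficient of w^n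
  Minv : Series → Series
  Minv g zero    = 0#
  Minv g (suc k) = sgn (suc k) * bcoef g k

  -- expansion of 1/(z + j) in (1/z)K[[1/z]]: w/(1 + j w) = Σ_{m≥0} (-j)^m w^{m+1}
  invLin : ℕ → Series
  invLin j zero    = 0#
  invLin j (suc m) = (- ι F j) ^K m

  invRisingProd : ℕ → Series
  invRisingProd zero    = invLin zero
  invRisingProd (suc k) = invRisingProd k ⋆ invLin (suc k)

  rhsTerm : Series → ℕ → Series
  rhsTerm a k n = (sgn (suc k) * (a k * ι F (k !ℕ))) * invRisingProd k n

  -- the 1/z-adically convergent sum over k ≥ 0: the k-th term has
  -- w-adic valuation ≥ k+1, so the coefficient of w^n only receives
  -- contributions from k ≤ n
  rhs : Series → Series
  rhs a n = ∑≤ n (λ k → rhsTerm a k n)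

-- Comparing coefficients of w^(k+1), where w = 1/z, both sides equal
-- (-1)^(k+1) Σ_j a_j j! S(k,j) with S the Stirling numbers of the second kind.
-- On the exponential side k! [z^k] (e^z - 1)^j = j! S(k,j), because the Euler
-- operator θ = z d/dz satisfies θ (e^z - 1)^(j+1) = (j+1) z ((e^z - 1)^(j+1) + (e^z - 1)^j).
-- On the rational side [w^(k+1)] 1/(z(z+1)⋯(z+j)) = (-1)^(k-j) S(k,j), because
-- R_j = 1/(z(z+1)⋯(z+j)) satisfies (z + j + 1) R_(j+1) = R_j.  In both cases the
-- coefficients obey the recurrence S(k+1,j+1) = (j+1) S(k,j+1) + S(k,j).
module Submission where

open import Defs
open import Level using (Level)
open import Algebra.Bundles using (CommutativeMonoid)
open import Data.Maybe using (nothing)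
open import Data.Product using (proj₂)
open import Data.Nat using (ℕ; zero; suc; _∸_; _≤_; _<_; z≤n; s≤s; _!)
import Data.Nat as ℕ
open import Data.Nat.Properties using (≤-refl; m≤n⇒m≤1+n; m<n⇒m<1+n; +-∸-assoc; n∸n≡0; m+[n∸m]≡n; *-zeroʳ; _!≢0)
open import Relation.Binary.PropositionalEquality as ≡ using (_≡_)
import Algebra.Construct.Pointwise as Pointwise
import Algebra.Properties.CommutativeSemigroup as CommutativeSemigroupProperties
import Algebra.Properties.Ring as RingProperties
import Algebra.Properties.Semiring.Mult as SemiringMult
import Algebra.Solver.Ring.NaturalCoefficients as NaturalCoefficientsSolver
import Relation.Binary.Reasoning.Setoid as SetoidReasoning

stirling₂ : ℕ → ℕ → ℕ
stirling₂ zero    zero    = 1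
stirling₂ zero    (suc j) = 0
stirling₂ (suc k) zero    = 0
stirling₂ (suc k) (suc j) = suc j ℕ.* stirling₂ k (suc j) ℕ.+ stirling₂ k j

stirling₂-< : ∀ {k j} → k < j → stirling₂ k j ≡ 0
stirling₂-< {zero}  {suc j} _         = ≡.refl
stirling₂-< {suc k} {suc j} (s≤s k<j)
  rewrite stirling₂-< (m<n⇒m<1+n k<j) | stirling₂-< k<j | *-zeroʳ j = ≡.refl

module _ {c ℓ : Level} (F : Field c ℓ) (char0 : CharZero F) where
  open Field F
  open PowerSeries F char0
  open RingProperties ring using (-1*x≈-x; -0#≈0#)
  open CommutativeSemigroupProperties +-commutativeSemigroup using () renaming (interchange to +-interchange)
  open CommutativeSemigroupProperties *-commutativeSemigroup using (x∙yz≈y∙xz; x∙yz≈yx∙z; xy∙z≈y∙xz)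
  open SemiringMult semiring using (_×_; ×-homo-+; ×1-homo-*)
  open NaturalCoefficientsSolver commutativeSemiring (λ _ _ → nothing)
    using (solve; _:+_; _:*_; _:=_)
  module ≈-Reasoning = SetoidReasoning setoid

  ι≡×1# : ∀ n → ι F n ≡ n × 1#
  ι≡×1# zero    = ≡.refl
  ι≡×1# (suc n) = ≡.cong (1# +_) (ι≡×1# n)

  ι-homo-+ : ∀ m n → ι F (m ℕ.+ n) ≈ ι F m + ι F n
  ι-homo-+ m n rewrite ι≡×1# m | ι≡×1# n | ι≡×1# (m ℕ.+ n) = ×-homo-+ 1# m n

  ι-homo-* : ∀ m n → ι F (m ℕ.* n) ≈ ι F m * ι F n
  ι-homo-* m n rewrite ι≡×1# m | ι≡×1# n | ι≡×1# (m ℕ.* n) = ×1-homo-* m n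

  ι-stirling₂-suc : ∀ k j → ι F (stirling₂ (suc k) (suc j))
                          ≈ ι F (suc j) * ι F (stirling₂ k (suc j)) + ι F (stirling₂ k j)
  ι-stirling₂-suc k j =
    trans (ι-homo-+ (suc j ℕ.* stirling₂ k (suc j)) _) (+-congʳ (ι-homo-* (suc j) (stirling₂ k (suc j))))

  inverse-unique : ∀ {x a b} → x * a ≈ 1# → x * b ≈ 1# → a ≈ b
  inverse-unique {x} {a} {b} xa≈1 xb≈1 = begin
    a           ≈⟨ *-identityʳ a ⟨
    a * 1#      ≈⟨ *-congˡ xb≈1 ⟨
    a * (x * b) ≈⟨ *-assoc a x b ⟨
    (a * x) * b ≈⟨ *-congʳ (*-comm a x) ⟩
    (x * a) * b ≈⟨ *-congʳ xa≈1 ⟩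
    1# * b      ≈⟨ *-identityˡ b ⟩
    b           ∎
    where open ≈-Reasoning

  ι[n!]*invFact≈1 : ∀ n → ι F (n !) * invFact n ≈ 1#
  ι[n!]*invFact≈1 n with n ! | n !≢0
  ... | zero  | record { nonZero = () }
  ... | suc m | _ = proj₂ (inverse (ι F (suc m)) (char0 m))

  ι1≈1 : ι F 1 ≈ 1#
  ι1≈1 = +-identityʳ 1#

  invFact-zero : invFact 0 ≈ 1#
  invFact-zero = inverse-unique (ι[n!]*invFact≈1 0) (trans (*-identityʳ _) ι1≈1)

  ι[1+n]*invFact[1+n]≈invFact[n] : ∀ n → ι F (suc n) * invFact (suc n) ≈ invFact n
  ι[1+n]*invFact[1+n]≈invFact[n] n = inverse-unique ι[n!]*ι[1+n]*invFact[1+n]≈1 (ι[n!]*invFact≈1 n)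
    where
    open ≈-Reasoning
    ι[n!]*ι[1+n]*invFact[1+n]≈1 : ι F (n !) * (ι F (suc n) * invFact (suc n)) ≈ 1#
    ι[n!]*ι[1+n]*invFact[1+n]≈1 = begin
      ι F (n !) * (ι F (suc n) * invFact (suc n)) ≈⟨ x∙yz≈yx∙z _ _ _ ⟩
      ι F (suc n) * ι F (n !) * invFact (suc n)   ≈⟨ *-congʳ (ι-homo-* (suc n) (n !)) ⟨
      ι F (suc n !) * invFact (suc n)             ≈⟨ ι[n!]*invFact≈1 (suc n) ⟩
      1#                                          ∎

  ∑≤-cong : ∀ n {f g : ℕ → Carrier} → (∀ i → i ≤ n → f i ≈ g i) → ∑≤ n f ≈ ∑≤ n g
  ∑≤-cong zero    f≈g = f≈g 0 z≤n
  ∑≤-cong (suc n) f≈g = +-cong (∑≤-cong n (λ i i≤n → f≈g i (m≤n⇒m≤1+n i≤n))) (f≈g (suc n) ≤-refl)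

  ∑≤-zero : ∀ n → ∑≤ n (λ _ → 0#) ≈ 0#
  ∑≤-zero zero    = refl
  ∑≤-zero (suc n) = trans (+-congʳ (∑≤-zero n)) (+-identityʳ 0#)

  ∑≤-distrib-+ : ∀ n (f g : ℕ → Carrier) → ∑≤ n (λ i → f i + g i) ≈ ∑≤ n f + ∑≤ n g
  ∑≤-distrib-+ zero    f g = refl
  ∑≤-distrib-+ (suc n) f g = trans (+-congʳ (∑≤-distrib-+ n f g)) (+-interchange _ _ _ _)

  *-distribˡ-∑≤ : ∀ n a (f : ℕ → Carrier) → a * ∑≤ n f ≈ ∑≤ n (λ i → a * f i)
  *-distribˡ-∑≤ zero    a f = refl
  *-distribˡ-∑≤ (suc n) a f = trans (distribˡ a _ _) (+-congʳ (*-distribˡ-∑≤ n a f))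

  ∑≤-suc : ∀ n (f : ℕ → Carrier) → ∑≤ (suc n) f ≈ f 0 + ∑≤ n (λ i → f (suc i))
  ∑≤-suc zero    f = refl
  ∑≤-suc (suc n) f = trans (+-congʳ (∑≤-suc n f)) (+-assoc _ _ _)

  open CommutativeMonoid (Pointwise.commutativeMonoid ℕ +-commutativeMonoid)
    using () renaming
      ( _≈_ to _≋_; _∙_ to infixl 6 _⊕_; ε to 0S; setoid to ≋-setoid
      ; ∙-cong to ⊕-cong; ∙-congˡ to ⊕-congˡ; ∙-congʳ to ⊕-congʳ)
  module ≋-Reasoning = SetoidReasoning ≋-setoid

  infixr 7 _•_
  _•_ : Carrier → Series → Series
  (a • f) n = a * f n

  X* : Series → Series
  X* f zero    = 0#
  X* f (suc n) = f n

  -- the Euler operator z d/dz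
  θ : Series → Series
  θ f n = ι F n * f n

  •-congˡ : ∀ {a f g} → f ≋ g → a • f ≋ a • g
  •-congˡ f≋g n = *-congˡ (f≋g n)

  X*-cong : ∀ {f g} → f ≋ g → X* f ≋ X* g
  X*-cong f≋g zero    = refl
  X*-cong f≋g (suc n) = f≋g n

  ⊕-ι• : ∀ n f → f ⊕ ι F n • f ≋ ι F (suc n) • f
  ⊕-ι• n f i = sym (trans (distribʳ _ _ _) (+-congʳ (*-identityˡ _)))

  ⋆-congˡ : ∀ f {g h} → g ≋ h → f ⋆ g ≋ f ⋆ h
  ⋆-congˡ f g≋h n = ∑≤-cong n (λ i _ → *-congˡ (g≋h (n ∸ i)))

  ⋆-congʳ : ∀ {f g} h → f ≋ g → f ⋆ h ≋ g ⋆ h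
  ⋆-congʳ h f≋g n = ∑≤-cong n (λ i _ → *-congʳ (f≋g i))

  ⋆-distribˡ-⊕ : ∀ f g h → f ⋆ (g ⊕ h) ≋ f ⋆ g ⊕ f ⋆ h
  ⋆-distribˡ-⊕ f g h n = trans (∑≤-cong n (λ i _ → distribˡ _ _ _)) (∑≤-distrib-+ n _ _)

  ⋆-distribʳ-⊕ : ∀ f g h → (f ⊕ g) ⋆ h ≋ f ⋆ h ⊕ g ⋆ h
  ⋆-distribʳ-⊕ f g h n = trans (∑≤-cong n (λ i _ → distribʳ _ _ _)) (∑≤-distrib-+ n _ _)

  ⋆-•ʳ : ∀ a f g → f ⋆ (a • g) ≋ a • (f ⋆ g)
  ⋆-•ʳ a f g n = trans (∑≤-cong n (λ i _ → x∙yz≈y∙xz _ _ _)) (sym (*-distribˡ-∑≤ n a _))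

  ⋆-zeroʳ : ∀ f → f ⋆ 0S ≋ 0S
  ⋆-zeroʳ f n = trans (∑≤-cong n (λ i _ → zeroʳ _)) (∑≤-zero n)

  ⋆-suc : ∀ f g n → (f ⋆ g) (suc n) ≈ ∑≤ n (λ i → f i * g (suc (n ∸ i))) + f (suc n) * g 0
  ⋆-suc f g n = +-cong
    (∑≤-cong n (λ i i≤n → *-congˡ (reflexive (≡.cong g (+-∸-assoc 1 i≤n)))))
    (*-congˡ (reflexive (≡.cong g (n∸n≡0 n))))

  ⋆-identityˡ : ∀ f → one ⋆ f ≋ f
  ⋆-identityˡ f zero    = *-identityˡ _
  ⋆-identityˡ f (suc n) = begin
    (one ⋆ f) (suc n)                             ≈⟨ ∑≤-suc n _ ⟩
    1# * f (suc n) + ∑≤ n (λ i → 0# * f (n ∸ i))  ≈⟨ +-cong (*-identityˡ _) (∑≤-cong n (λ i _ → zeroˡ _)) ⟩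
    f (suc n) + ∑≤ n (λ _ → 0#)                   ≈⟨ +-congˡ (∑≤-zero n) ⟩
    f (suc n) + 0#                                ≈⟨ +-identityʳ _ ⟩
    f (suc n)                                     ∎
    where open ≈-Reasoning

  ⋆-identityʳ : ∀ f → f ⋆ one ≋ f
  ⋆-identityʳ f zero    = *-identityʳ _
  ⋆-identityʳ f (suc n) = begin
    (f ⋆ one) (suc n)                       ≈⟨ ⋆-suc f one n ⟩
    ∑≤ n (λ i → f i * 0#) + f (suc n) * 1#  ≈⟨ +-cong (∑≤-cong n (λ i _ → zeroʳ _)) (*-identityʳ _) ⟩
    ∑≤ n (λ _ → 0#) + f (suc n)             ≈⟨ +-congʳ (∑≤-zero n) ⟩
    0# + f (suc n)                          ≈⟨ +-identityˡ _ ⟩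
    f (suc n)                               ∎
    where open ≈-Reasoning

  X*-⋆ : ∀ f g → X* f ⋆ g ≋ X* (f ⋆ g)
  X*-⋆ f g zero    = zeroˡ _
  X*-⋆ f g (suc n) = trans (∑≤-suc n _) (trans (+-congʳ (zeroˡ _)) (+-identityˡ _))

  ⋆-X* : ∀ f g → f ⋆ X* g ≋ X* (f ⋆ g)
  ⋆-X* f g zero    = zeroʳ _
  ⋆-X* f g (suc n) = trans (⋆-suc f (X* g) n) (trans (+-congˡ (zeroʳ _)) (+-identityʳ _))

  θ-⋆ : ∀ f g → θ (f ⋆ g) ≋ θ f ⋆ g ⊕ f ⋆ θ g
  θ-⋆ f g n = begin
    ι F n * ∑≤ n (λ i → f i * g (n ∸ i))
      ≈⟨ *-distribˡ-∑≤ n _ _ ⟩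
    ∑≤ n (λ i → ι F n * (f i * g (n ∸ i)))
      ≈⟨ ∑≤-cong n (λ i i≤n → trans (*-congʳ (ι-split i≤n)) (split _ _ _ _)) ⟩
    ∑≤ n (λ i → ι F i * f i * g (n ∸ i) + f i * (ι F (n ∸ i) * g (n ∸ i)))
      ≈⟨ ∑≤-distrib-+ n _ _ ⟩
    (θ f ⋆ g ⊕ f ⋆ θ g) n ∎
    where
    open ≈-Reasoning
    ι-split : ∀ {i} → i ≤ n → ι F n ≈ ι F i + ι F (n ∸ i)
    ι-split {i} i≤n = trans (reflexive (≡.cong (ι F) (≡.sym (m+[n∸m]≡n i≤n)))) (ι-homo-+ i (n ∸ i))
    split : ∀ a b x y → (a + b) * (x * y) ≈ a * x * y + x * (b * y)
    split = solve 4 (λ a b x y → (a :+ b) :* (x :* y) := a :* x :* y :+ x :* (b :* y)) refl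

  -- The exponential side

  E : Series
  E = expMinusOne

  θE≋X*[E⊕1] : θ E ≋ X* (E ⊕ one)
  θE≋X*[E⊕1] zero          = zeroˡ _
  θE≋X*[E⊕1] (suc zero)    = trans (ι[1+n]*invFact[1+n]≈invFact[n] 0) (trans invFact-zero (sym (+-identityˡ 1#)))
  θE≋X*[E⊕1] (suc (suc n)) = trans (ι[1+n]*invFact[1+n]≈invFact[n] (suc n)) (sym (+-identityʳ _))

  θ-E⋆ : ∀ f → θ (E ⋆ f) ≋ X* (E ⋆ f ⊕ f) ⊕ E ⋆ θ f
  θ-E⋆ f = begin
    θ (E ⋆ f)                      ≈⟨ θ-⋆ E f ⟩
    θ E ⋆ f ⊕ E ⋆ θ f              ≈⟨ ⊕-congʳ (⋆-congʳ f θE≋X*[E⊕1]) ⟩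
    X* (E ⊕ one) ⋆ f ⊕ E ⋆ θ f     ≈⟨ ⊕-congʳ (X*-⋆ (E ⊕ one) f) ⟩
    X* ((E ⊕ one) ⋆ f) ⊕ E ⋆ θ f   ≈⟨ ⊕-congʳ (X*-cong (⋆-distribʳ-⊕ E one f)) ⟩
    X* (E ⋆ f ⊕ one ⋆ f) ⊕ E ⋆ θ f ≈⟨ ⊕-congʳ (X*-cong (⊕-congˡ (⋆-identityˡ f))) ⟩
    X* (E ⋆ f ⊕ f) ⊕ E ⋆ θ f       ∎
    where open ≋-Reasoning

  θ-one : θ one ≋ 0S
  θ-one zero    = zeroˡ _
  θ-one (suc n) = zeroʳ _

  θ[E^S1+j] : ∀ j → θ (E ^S suc j) ≋ ι F (suc j) • X* (E ^S suc j ⊕ E ^S j)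
  E⋆θ[E^Sj] : ∀ j → E ⋆ θ (E ^S j) ≋ ι F j • X* (E ^S suc j ⊕ E ^S j)

  θ[E^S1+j] j = begin
    θ (E ⋆ (E ^S j))                                            ≈⟨ θ-E⋆ (E ^S j) ⟩
    X* (E ^S suc j ⊕ E ^S j) ⊕ E ⋆ θ (E ^S j)                   ≈⟨ ⊕-congˡ (E⋆θ[E^Sj] j) ⟩
    X* (E ^S suc j ⊕ E ^S j) ⊕ ι F j • X* (E ^S suc j ⊕ E ^S j) ≈⟨ ⊕-ι• j _ ⟩
    ι F (suc j) • X* (E ^S suc j ⊕ E ^S j)                      ∎
    where open ≋-Reasoning

  E⋆θ[E^Sj] zero n = trans (⋆-congˡ E θ-one n) (trans (⋆-zeroʳ E n) (sym (zeroˡ _)))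
  E⋆θ[E^Sj] (suc j) = begin
    E ⋆ θ (E ^S suc j)                   ≈⟨ ⋆-congˡ E (θ[E^S1+j] j) ⟩
    E ⋆ (ι F (suc j) • X* h)             ≈⟨ ⋆-•ʳ (ι F (suc j)) E (X* h) ⟩
    ι F (suc j) • (E ⋆ X* h)             ≈⟨ •-congˡ (⋆-X* E h) ⟩
    ι F (suc j) • X* (E ⋆ h)             ≈⟨ •-congˡ (X*-cong (⋆-distribˡ-⊕ E (E ^S suc j) (E ^S j))) ⟩
    ι F (suc j) • X* (E ^S suc (suc j) ⊕ E ^S suc j) ∎
    where
    open ≋-Reasoning
    h : Series
    h = E ^S suc j ⊕ E ^S j

  ι[k!]*[E^Sj]≈ι[j!]*ι[S] : ∀ k j → ι F (k !) * (E ^S j) k ≈ ι F (j !) * ι F (stirling₂ k j)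
  ι[k!]*[E^Sj]≈ι[j!]*ι[S] zero    zero    = *-congˡ (sym ι1≈1)
  ι[k!]*[E^Sj]≈ι[j!]*ι[S] zero    (suc j) = trans (*-congˡ (zeroˡ _)) (trans (zeroʳ _) (sym (zeroʳ _)))
  ι[k!]*[E^Sj]≈ι[j!]*ι[S] (suc k) zero    = trans (zeroʳ _) (sym (zeroʳ _))
  ι[k!]*[E^Sj]≈ι[j!]*ι[S] (suc k) (suc j) = begin
    ι F (suc k !) * (E ^S suc j) (suc k)
      ≈⟨ *-congʳ (ι-homo-* (suc k) (k !)) ⟩
    ι F (suc k) * ι F (k !) * (E ^S suc j) (suc k)
      ≈⟨ xy∙z≈y∙xz _ _ _ ⟩
    ι F (k !) * θ (E ^S suc j) (suc k)
      ≈⟨ *-congˡ (θ[E^S1+j] j (suc k)) ⟩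
    ι F (k !) * (ι F (suc j) * ((E ^S suc j) k + (E ^S j) k))
      ≈⟨ expand _ _ _ _ ⟩
    ι F (suc j) * (ι F (k !) * (E ^S suc j) k) + ι F (suc j) * (ι F (k !) * (E ^S j) k)
      ≈⟨ +-cong (*-congˡ (ι[k!]*[E^Sj]≈ι[j!]*ι[S] k (suc j))) (*-congˡ (ι[k!]*[E^Sj]≈ι[j!]*ι[S] k j)) ⟩
    ι F (suc j) * (ι F (suc j !) * S₁) + ι F (suc j) * (ι F (j !) * S₀)
      ≈⟨ collect _ _ _ _ _ ⟩
    ι F (suc j !) * (ι F (suc j) * S₁) + (ι F (suc j) * ι F (j !)) * S₀
      ≈⟨ +-congˡ (*-congʳ (ι-homo-* (suc j) (j !))) ⟨
    ι F (suc j !) * (ι F (suc j) * S₁) + ι F (suc j !) * S₀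
      ≈⟨ distribˡ _ _ _ ⟨
    ι F (suc j !) * (ι F (suc j) * S₁ + S₀)
      ≈⟨ *-congˡ (ι-stirling₂-suc k j) ⟨
    ι F (suc j !) * ι F (stirling₂ (suc k) (suc j)) ∎
    where
    open ≈-Reasoning
    S₁ S₀ : Carrier
    S₁ = ι F (stirling₂ k (suc j))
    S₀ = ι F (stirling₂ k j)
    expand : ∀ f i x y → f * (i * (x + y)) ≈ i * (f * x) + i * (f * y)
    expand = solve 4 (λ f i x y → f :* (i :* (x :+ y)) := i :* (f :* x) :+ i :* (f :* y)) refl
    collect : ∀ i F₁ F₀ s₁ s₀ → i * (F₁ * s₁) + i * (F₀ * s₀) ≈ F₁ * (i * s₁) + (i * F₀) * s₀
    collect = solve 5 (λ i F₁ F₀ s₁ s₀ →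
      i :* (F₁ :* s₁) :+ i :* (F₀ :* s₀) := F₁ :* (i :* s₁) :+ (i :* F₀) :* s₀) refl

  -- The rational side

  -- 1/(z + j) = w (1 - j/(z + j))
  invLin≋X*[1⊕-j•invLin] : ∀ j → invLin j ≋ X* (one ⊕ (- ι F j) • invLin j)
  invLin≋X*[1⊕-j•invLin] j zero          = refl
  invLin≋X*[1⊕-j•invLin] j (suc zero)    = sym (trans (+-congˡ (zeroʳ _)) (+-identityʳ _))
  invLin≋X*[1⊕-j•invLin] j (suc (suc m)) = sym (+-identityˡ _)

  -- (z + j + 1) R_(j+1) = R_j
  invRisingProd-suc : ∀ j → invRisingProd (suc j)
                          ≋ X* (invRisingProd j ⊕ (- ι F (suc j)) • invRisingProd (suc j))
  invRisingProd-suc j = begin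
    R j ⋆ L                         ≈⟨ ⋆-congˡ (R j) (invLin≋X*[1⊕-j•invLin] (suc j)) ⟩
    R j ⋆ X* (one ⊕ x • L)          ≈⟨ ⋆-X* (R j) (one ⊕ x • L) ⟩
    X* (R j ⋆ (one ⊕ x • L))        ≈⟨ X*-cong (⋆-distribˡ-⊕ (R j) one (x • L)) ⟩
    X* (R j ⋆ one ⊕ R j ⋆ (x • L))  ≈⟨ X*-cong (⊕-cong (⋆-identityʳ (R j)) (⋆-•ʳ x (R j) L)) ⟩
    X* (R j ⊕ x • (R j ⋆ L))        ∎
    where
    open ≋-Reasoning
    R : ℕ → Series
    R = invRisingProd
    L : Series
    L = invLin (suc j)
    x : Carrier
    x = - ι F (suc j)

  invRisingProd-zero : ∀ j → invRisingProd j 0 ≈ 0#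
  invRisingProd-zero zero    = refl
  invRisingProd-zero (suc j) = zeroʳ _

  sgn*invRisingProd≈sgn*ι[S] : ∀ k j → sgn j * invRisingProd j (suc k) ≈ sgn k * ι F (stirling₂ k j)
  sgn*invRisingProd≈sgn*ι[S] zero    zero    = *-congˡ (sym ι1≈1)
  sgn*invRisingProd≈sgn*ι[S] zero    (suc j) = trans (*-congˡ R[1+j]₁≈0) (trans (zeroʳ _) (sym (zeroʳ _)))
    where
    R[1+j]₁≈0 : invRisingProd (suc j) 1 ≈ 0#
    R[1+j]₁≈0 = trans (invRisingProd-suc j 1)
      (trans (+-cong (invRisingProd-zero j) (trans (*-congˡ (invRisingProd-zero (suc j))) (zeroʳ _)))
             (+-identityʳ 0#))
  sgn*invRisingProd≈sgn*ι[S] (suc k) zero    =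
    trans (*-identityˡ _) (trans (*-congʳ -0#≈0#) (trans (zeroˡ _) (sym (zeroʳ _))))
  sgn*invRisingProd≈sgn*ι[S] (suc k) (suc j) = begin
    sgn (suc j) * R (suc j) (suc (suc k))
      ≈⟨ *-congˡ (invRisingProd-suc j (suc (suc k))) ⟩
    - 1# * sgn j * (R j (suc k) + (- ι F (suc j)) * R (suc j) (suc k))
      ≈⟨ *-congˡ (+-congˡ (*-congʳ (-1*x≈-x _))) ⟨
    - 1# * sgn j * (R j (suc k) + (- 1# * ι F (suc j)) * R (suc j) (suc k))
      ≈⟨ expand _ _ _ _ _ ⟩
    - 1# * (sgn j * R j (suc k)) + - 1# * ι F (suc j) * (- 1# * sgn j * R (suc j) (suc k))
      ≈⟨ +-cong (*-congˡ (sgn*invRisingProd≈sgn*ι[S] k j)) (*-congˡ (sgn*invRisingProd≈sgn*ι[S] k (suc j))) ⟩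
    - 1# * (sgn k * S₀) + - 1# * ι F (suc j) * (sgn k * S₁)
      ≈⟨ collect _ _ _ _ _ ⟩
    - 1# * sgn k * (ι F (suc j) * S₁ + S₀)
      ≈⟨ *-congˡ (ι-stirling₂-suc k j) ⟨
    sgn (suc k) * ι F (stirling₂ (suc k) (suc j)) ∎
    where
    open ≈-Reasoning
    R : ℕ → Series
    R = invRisingProd
    S₁ S₀ : Carrier
    S₁ = ι F (stirling₂ k (suc j))
    S₀ = ι F (stirling₂ k j)
    expand : ∀ m s v₀ i v₁ → m * s * (v₀ + m * i * v₁) ≈ m * (s * v₀) + m * i * (m * s * v₁)
    expand = solve 5 (λ m s v₀ i v₁ →
      m :* s :* (v₀ :+ m :* i :* v₁) := m :* (s :* v₀) :+ m :* i :* (m :* s :* v₁)) refl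
    collect : ∀ m s s₀ i s₁ → m * (s * s₀) + m * i * (s * s₁) ≈ m * s * (i * s₁ + s₀)
    collect = solve 5 (λ m s s₀ i s₁ →
      m :* (s :* s₀) :+ m :* i :* (s :* s₁) := m :* s :* (i :* s₁ :+ s₀)) refl

  signedStirlingSum : Series → ℕ → Carrier
  signedStirlingSum a k = ∑≤ k (λ j → sgn (suc k) * (a j * (ι F (j !) * ι F (stirling₂ k j))))

  Minv≈signedStirlingSum : ∀ a k → Minv a (suc k) ≈ signedStirlingSum a k
  Minv≈signedStirlingSum a k = begin
    sgn (suc k) * (ι F (k !) * ∑≤ k (λ j → a j * (E ^S j) k))
      ≈⟨ *-congˡ (*-distribˡ-∑≤ k _ _) ⟩
    sgn (suc k) * ∑≤ k (λ j → ι F (k !) * (a j * (E ^S j) k))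
      ≈⟨ *-distribˡ-∑≤ k _ _ ⟩
    ∑≤ k (λ j → sgn (suc k) * (ι F (k !) * (a j * (E ^S j) k)))
      ≈⟨ ∑≤-cong k (λ j _ → *-congˡ (trans (x∙yz≈y∙xz _ _ _) (*-congˡ (ι[k!]*[E^Sj]≈ι[j!]*ι[S] k j)))) ⟩
    signedStirlingSum a k ∎
    where open ≈-Reasoning

  rhs≈signedStirlingSum : ∀ a k → rhs a (suc k) ≈ signedStirlingSum a k
  rhs≈signedStirlingSum a k = begin
    ∑≤ (suc k) (λ j → rhsTerm a j (suc k))   ≈⟨ ∑≤-cong (suc k) (λ j _ → rhsTerm≈ j) ⟩
    signedStirlingSum a k + T (suc k)        ≈⟨ +-congˡ T[1+k]≈0 ⟩
    signedStirlingSum a k + 0#               ≈⟨ +-identityʳ _ ⟩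
    signedStirlingSum a k                    ∎
    where
    open ≈-Reasoning
    T : ℕ → Carrier
    T j = sgn (suc k) * (a j * (ι F (j !) * ι F (stirling₂ k j)))
    T[1+k]≈0 : T (suc k) ≈ 0#
    T[1+k]≈0 = trans (*-congˡ (*-congˡ (trans (*-congˡ ι[S]≈0) (zeroʳ _)))) (trans (*-congˡ (zeroʳ _)) (zeroʳ _))
      where
      ι[S]≈0 : ι F (stirling₂ k (suc k)) ≈ 0#
      ι[S]≈0 = reflexive (≡.cong (ι F) (stirling₂-< {k} ≤-refl))
    regroup : ∀ m s x v → m * s * x * v ≈ m * x * (s * v)
    regroup = solve 4 (λ m s x v → m :* s :* x :* v := m :* x :* (s :* v)) refl
    regroup′ : ∀ m x f s y → m * (x * f) * (s * y) ≈ m * s * (x * (f * y))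
    regroup′ = solve 5 (λ m x f s y → m :* (x :* f) :* (s :* y) := m :* s :* (x :* (f :* y))) refl
    rhsTerm≈ : ∀ j → rhsTerm a j (suc k) ≈ T j
    rhsTerm≈ j = begin
      - 1# * sgn j * (a j * ι F (j !)) * invRisingProd j (suc k)
        ≈⟨ regroup _ _ _ _ ⟩
      - 1# * (a j * ι F (j !)) * (sgn j * invRisingProd j (suc k))
        ≈⟨ *-congˡ (sgn*invRisingProd≈sgn*ι[S] k j) ⟩
      - 1# * (a j * ι F (j !)) * (sgn k * ι F (stirling₂ k j))
        ≈⟨ regroup′ _ _ _ _ _ ⟩
      T j ∎

proposition3p6 : {c ℓ : Level} (F : Field c ℓ) (char0 : CharZero F)
                 (g : ℕ → Field.Carrier F) (n : ℕ) →
                 Field._≈_ F (PowerSeries.Minv F char0 g n) (PowerSeries.rhs F char0 g n)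
proposition3p6 F char0 g zero    = sym (zeroʳ _)
  where open Field F
proposition3p6 F char0 g (suc k) =
  trans (Minv≈signedStirlingSum F char0 g k) (sym (rhs≈signedStirlingSum F char0 g k))
  where open Field F
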